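{- Let $d\ge 2$ and $n,k\ge 0$ be integers. Then $N_d(n,k)$ equals the number of labelled ordered trees in $\widetilde{\mathcal{T}}_d$ with $n+1$ edges and $k+1$ leaves.
   Context: $N_d(n,k) = \frac{1}{n+1} \binom{n+1}{k+1} \binom{ n + (n-k)(d-2)+1}{k}$. An ordered tree is a rooted tree in which the children of each vertex are linearly ordered; the outdegree of a vertex is its number of children, leaves have outdegree $0$ and internal nodes positive outdegree. $\widetilde{\mathcal{T}}_d$ is the set of ordered trees together with labellings such that the root is an internal node and is unlabelled, and every non-root internal node with outdegree $\ell\ge 1$ is labelled by a composition of $\ell-1$ into $d-1$ nonnegative parts (leaves are unlabelled). -}

module Defs where

open import Data.Nat using (ℕ; zero; suc; _+_; _*_; _∸_; _/_; _≤_)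
open import Data.Nat.Combinatorics using (_C_)
open import Data.List using (List; []; _∷_; length)
open import Data.Vec using (Vec)
open import Relation.Binary.PropositionalEquality using (_≡_)

vsum : ∀ {p} → Vec ℕ p → ℕ
vsum Vec.[] = 0
vsum (x Vec.∷ v) = x + vsum v

record Composition (m p : ℕ) : Set where
  constructor comp
  field
    parts  : Vec ℕ p
    sumIsM : vsum parts ≡ m

-- Non-root subtrees of a tree in T̃_d.
-- A non-root vertex is either a leaf (unlabelled), or an internal node with
-- outdegree ℓ = 1 + length cs ≥ 1 (first child c, remaining children cs, in order),
-- labelled by a composition of ℓ - 1 = length cs into d - 1 nonnegative parts.
data SubTree (d : ℕ) : Set where
  leaf : SubTree d
  node : (c : SubTree d) (cs : List (SubTree d)) →
         Composition (length cs) (d ∸ 1) → SubTree d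

-- Trees in T̃_d: the root is internal (at least one child: c, then cs) and unlabelled.
data Tree (d : ℕ) : Set where
  root : (c : SubTree d) (cs : List (SubTree d)) → Tree d

mutual
  edgesS : ∀ {d} → SubTree d → ℕ
  edgesS leaf = 0
  edgesS (node c cs _) = suc (edgesS c) + edgesL cs

  edgesL : ∀ {d} → List (SubTree d) → ℕ
  edgesL [] = 0
  edgesL (t ∷ ts) = suc (edgesS t) + edgesL ts

mutual
  leavesS : ∀ {d} → SubTree d → ℕ
  leavesS leaf = 1
  leavesS (node c cs _) = leavesS c + leavesL cs

  leavesL : ∀ {d} → List (SubTree d) → ℕ
  leavesL [] = 0
  leavesL (t ∷ ts) = leavesS t + leavesL ts

edges : ∀ {d} → Tree d → ℕ
edges (root c cs) = suc (edgesS c) + edgesL cs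

leaves : ∀ {d} → Tree d → ℕ
leaves (root c cs) = leavesS c + leavesL cs

-- N_d(n,k) = 1/(n+1) * C(n+1,k+1) * C(n + (n-k)(d-2) + 1, k).
-- (n ∸ k is truncated subtraction; when k > n the factor C(n+1,k+1) is 0 anyway.)
N : ℕ → ℕ → ℕ → ℕ
N d n k = ((suc n C suc k) * ((n + (n ∸ k) * (d ∸ 2) + 1) C k)) / suc n

-- Removing the root of a tree of T̃_d leaves an ordered forest, counted by its number N of
-- edges, K of leaves and its slack S = K − (number of trees). Deleting the root of the first
-- tree either removes a leaf or replaces a node labelled by v ∈ ℕ^(d−1) by its 1 + |v| children,
-- lowering the slack by |v|; summing over such v is a (d−1)-fold partial sum. With q = d − 1 and
-- M_p(S) = C(S+p−1, S) (multichoose), the resulting recurrence is solved for S ≤ K by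
-- C(N,K−1)·M_{q(N+1−K)}(S) − q·C(N,K)·M_{q(N+1−K)+1}(S−1) (leading − correction), each term
-- satisfying it by Pascal's rule. Times N+1 this is the cycle-lemma count
-- (K−S)·C(N+1,K)·M_{q(N+1−K)}(S), and summing over the slack of the root's forest gives
-- (n+1)·#trees = C(n+1,k+1)·C(k+q(n−k)+1, k) = (n+1)·N_d(n,k).

module Submission where

open import Defs
open import Data.Nat using (ℕ; suc; _≤_)
open import Data.Fin using (Fin)
open import Data.Product using (Σ; _×_)
open import Function.Bundles using (_↔_)
open import Relation.Binary.PropositionalEquality using (_≡_)

open import Data.Nat
open import Data.Nat.Properties
open import Data.Nat.Combinatorics using (_C_; k>n⇒nCk≡0; nCk+nC[k+1]≡[n+1]C[k+1])
open import Data.Nat.DivMod using (m*n/n≡m)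
open import Relation.Binary.PropositionalEquality
open import Relation.Nullary using (¬_; yes; no; Irrelevant)
open import Data.Empty using (⊥-elim)
open import Data.Fin.Properties using (+↔⊎; 1↔⊤)
open import Data.Unit using (tt)
open import Data.List using (List; []; _∷_; _++_; length; take; drop)
open import Data.List.Properties using (length-++; length-take; length-drop; take++drop≡id)
open import Data.Product using (_,_; proj₁; proj₂)
open import Data.Sum using (_⊎_; inj₁; inj₂)
open import Data.Sum.Function.Propositional using (_⊎-↔_)
open import Data.Vec using (Vec; []; _∷_)
open import Function.Bundles using (mk↔ₛ′)
open import Function.Properties.Inverse using (↔-sym; ↔-trans)
open import Algebra.Properties.CommutativeSemigroup +-commutativeSemigroup using () renaming (interchange to +-interchange)
open import Algebra.Properties.CommutativeSemigroup *-commutativeSemigroup using () renaming (x∙yz≈y∙xz to *-left-swap)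
open import Data.Nat.Tactic.RingSolver using (solve-∀)
open ≡-Reasoning

[a*b]*[c*d]≡b*[c*a*d] : ∀ a b c d → a * b * (c * d) ≡ b * (c * a * d)
[a*b]*[c*d]≡b*[c*a*d] = solve-∀

*-suc-∸ : ∀ q {n k} → k < n → q + q * (n ∸ suc k) ≡ q * (n ∸ k)
*-suc-∸ q {n} {k} k<n = trans (sym (*-suc q (n ∸ suc k))) (cong (q *_) (sym (+-∸-assoc 1 k<n)))

-- Pascal's rule, unlike _C_ (defined by division), computes by pattern matching.
choose : ℕ → ℕ → ℕ
choose _       zero    = 1
choose zero    (suc k) = 0
choose (suc n) (suc k) = choose n k + choose n (suc k)

k>n⇒choose≡0 : ∀ {n k} → n < k → choose n k ≡ 0
k>n⇒choose≡0 {zero}  {suc k} _         = refl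
k>n⇒choose≡0 {suc n} {suc k} (s≤s n<k) =
  cong₂ _+_ (k>n⇒choose≡0 n<k) (k>n⇒choose≡0 (m≤n⇒m≤1+n n<k))

choose≡C : ∀ n k → choose n k ≡ n C k
choose≡C zero    zero    = refl
choose≡C (suc n) zero    = refl
choose≡C zero    (suc k) = sym (k>n⇒nCk≡0 (s≤s (z≤n {k})))
choose≡C (suc n) (suc k) = trans (cong₂ _+_ (choose≡C n k) (choose≡C n (suc k))) (nCk+nC[k+1]≡[n+1]C[k+1] n k)

choose-*-cong : ∀ n k {x y} → (k ≤ n → x ≡ y) → choose n k * x ≡ choose n k * y
choose-*-cong n k x≡y with k ≤? n
... | yes k≤n = cong (choose n k *_) (x≡y k≤n)
... | no  k≰n rewrite k>n⇒choose≡0 (≰⇒> k≰n) = refl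

choose-weighted-sum : ∀ n k → suc k * choose n (suc k) + k * choose n k ≡ n * choose n k
choose-weighted-sum zero    zero    = refl
choose-weighted-sum zero    (suc k) = cong₂ _+_ (*-zeroʳ (suc (suc k))) (*-zeroʳ (suc k))
choose-weighted-sum (suc n) zero    = cong suc (choose-weighted-sum n 0)
choose-weighted-sum (suc n) (suc k) = begin
  suc (suc k) * (c₁ + c₂) + suc k * (c₀ + c₁)
    ≡⟨ regroup k c₀ c₁ c₂ ⟩
  (suc (suc k) * c₂ + suc k * c₁) + (suc k * c₁ + k * c₀) + (c₀ + c₁)
    ≡⟨ cong₂ (λ x y → x + y + (c₀ + c₁)) (choose-weighted-sum n (suc k)) (choose-weighted-sum n k) ⟩
  n * c₁ + n * c₀ + (c₀ + c₁)
    ≡⟨ collect n c₀ c₁ ⟩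
  suc n * (c₀ + c₁) ∎
  where
  c₀ = choose n k
  c₁ = choose n (suc k)
  c₂ = choose n (suc (suc k))
  regroup : ∀ k c₀ c₁ c₂ → suc (suc k) * (c₁ + c₂) + suc k * (c₀ + c₁)
                         ≡ (suc (suc k) * c₂ + suc k * c₁) + (suc k * c₁ + k * c₀) + (c₀ + c₁)
  regroup = solve-∀
  collect : ∀ n c₀ c₁ → n * c₁ + n * c₀ + (c₀ + c₁) ≡ suc n * (c₀ + c₁)
  collect = solve-∀

choose-suc-ratio : ∀ n k → suc k * choose n (suc k) ≡ (n ∸ k) * choose n k
choose-suc-ratio n k = begin
  suc k * choose n (suc k)                           ≡⟨ m+n∸n≡m _ (k * choose n k) ⟨
  suc k * choose n (suc k) + k * choose n k ∸ k * choose n k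
                                                     ≡⟨ cong (_∸ k * choose n k) (choose-weighted-sum n k) ⟩
  n * choose n k ∸ k * choose n k                    ≡⟨ *-distribʳ-∸ (choose n k) n k ⟨
  (n ∸ k) * choose n k                               ∎

choose-absorption : ∀ n k → suc n * choose n k ≡ suc k * choose (suc n) (suc k)
choose-absorption n k = +-cancelʳ-≡ (k * c₀) _ _ (begin
  suc n * c₀ + k * c₀                  ≡⟨ swap n k c₀ ⟩
  suc k * c₀ + n * c₀                  ≡⟨ cong (suc k * c₀ +_) (choose-weighted-sum n k) ⟨
  suc k * c₀ + (suc k * c₁ + k * c₀)   ≡⟨ collect k c₀ c₁ ⟩
  suc k * (c₀ + c₁) + k * c₀           ∎)
  where
  c₀ = choose n k
  c₁ = choose n (suc k)
  swap : ∀ n k c → suc n * c + k * c ≡ suc k * c + n * c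
  swap = solve-∀
  collect : ∀ k c₀ c₁ → suc k * c₀ + (suc k * c₁ + k * c₀) ≡ suc k * (c₀ + c₁) + k * c₀
  collect = solve-∀

choose-absorption-suc : ∀ n k → suc n * choose n (suc k) ≡ (n ∸ k) * choose (suc n) (suc k)
choose-absorption-suc n k = trans (choose-absorption n (suc k)) (choose-suc-ratio (suc n) (suc k))

multichoose : ℕ → ℕ → ℕ
multichoose zero    zero    = 1
multichoose zero    (suc S) = 0
multichoose (suc p) zero    = 1
multichoose (suc p) (suc S) = multichoose (suc p) S + multichoose p (suc S)

multichoose-zero : ∀ p → multichoose p 0 ≡ 1
multichoose-zero zero    = refl
multichoose-zero (suc p) = refl

multichoose≡choose : ∀ p S → multichoose (suc p) S ≡ choose (S + p) S
multichoose≡choose p       zero    = refl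
multichoose≡choose zero    (suc S) =
  cong₂ _+_ (multichoose≡choose 0 S) (sym (k>n⇒choose≡0 (≤-reflexive (cong suc (+-identityʳ S)))))
multichoose≡choose (suc p) (suc S) =
  cong₂ _+_ (multichoose≡choose (suc p) S)
            (trans (multichoose≡choose p (suc S)) (cong (λ n → choose n (suc S)) (sym (+-suc S p))))

shift : (ℕ → ℕ) → ℕ → ℕ
shift f zero    = 0
shift f (suc S) = f S

shift-cong : ∀ {f g} S → (∀ t → f t ≡ g t) → shift f S ≡ shift g S
shift-cong zero    f≗g = refl
shift-cong (suc S) f≗g = f≗g S

multichoose-suc : ∀ p S → multichoose (suc p) S ≡ shift (multichoose (suc p)) S + multichoose p S
multichoose-suc p zero    = sym (multichoose-zero p)
multichoose-suc p (suc S) = refl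

*-multichoose : ∀ p S → S * multichoose p S ≡ p * shift (multichoose (suc p)) S
*-multichoose p       zero    = sym (*-zeroʳ p)
*-multichoose zero    (suc S) = *-zeroʳ (suc S)
*-multichoose (suc p) (suc S) = begin
  suc S * (a + b)                      ≡⟨ distribute S a b ⟩
  S * a + (a + suc S * b)
    ≡⟨ cong₂ (λ x y → x + (a + y)) (*-multichoose (suc p) S) (*-multichoose p (suc S)) ⟩
  suc p * s + suc p * a                ≡⟨ *-distribˡ-+ (suc p) s a ⟨
  suc p * (s + a)                      ≡⟨ cong (suc p *_) (multichoose-suc (suc p) S) ⟨
  suc p * multichoose (suc (suc p)) S  ∎
  where
  a = multichoose (suc p) S
  b = multichoose p (suc S)
  s = shift (multichoose (suc (suc p))) S
  distribute : ∀ S a b → suc S * (a + b) ≡ S * a + (a + suc S * b)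
  distribute = solve-∀

suc-*-multichoose : ∀ p k → suc k * multichoose (suc p) k
                          ≡ multichoose (suc (suc p)) k + p * shift (multichoose (suc (suc p))) k
suc-*-multichoose p k = begin
  multichoose (suc p) k + k * multichoose (suc p) k  ≡⟨ cong (multichoose (suc p) k +_) (*-multichoose (suc p) k) ⟩
  a + suc p * s                                      ≡⟨ rearrange a p s ⟩
  (s + a) + p * s                                    ≡⟨ cong (_+ p * s) (multichoose-suc (suc p) k) ⟨
  multichoose (suc (suc p)) k + p * s                ∎
  where
  a = multichoose (suc p) k
  s = shift (multichoose (suc (suc p))) k
  rearrange : ∀ a p s → a + suc p * s ≡ (s + a) + p * s
  rearrange = solve-∀

cumsum : (ℕ → ℕ) → ℕ → ℕ
cumsum f zero    = f zero
cumsum f (suc S) = cumsum f S + f (suc S)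

cumsum-cong-≤ : ∀ {f g} S → (∀ t → t ≤ S → f t ≡ g t) → cumsum f S ≡ cumsum g S
cumsum-cong-≤ zero    f≗g = f≗g 0 z≤n
cumsum-cong-≤ (suc S) f≗g =
  cong₂ _+_ (cumsum-cong-≤ S (λ t t≤S → f≗g t (m≤n⇒m≤1+n t≤S))) (f≗g (suc S) ≤-refl)

cumsum-+ : ∀ f g S → cumsum (λ t → f t + g t) S ≡ cumsum f S + cumsum g S
cumsum-+ f g zero    = refl
cumsum-+ f g (suc S) = trans (cong (_+ (f (suc S) + g (suc S))) (cumsum-+ f g S))
                             (+-interchange (cumsum f S) (cumsum g S) (f (suc S)) (g (suc S)))

cumsum-* : ∀ c f S → cumsum (λ t → c * f t) S ≡ c * cumsum f S
cumsum-* c f zero    = refl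
cumsum-* c f (suc S) = trans (cong (_+ c * f (suc S)) (cumsum-* c f S)) (sym (*-distribˡ-+ c _ _))

cumsum-shift : ∀ f S → cumsum (shift f) S ≡ shift (cumsum f) S
cumsum-shift f zero          = refl
cumsum-shift f (suc zero)    = refl
cumsum-shift f (suc (suc S)) = cong (_+ f (suc S)) (cumsum-shift f (suc S))

cumsum-multichoose : ∀ p S → cumsum (multichoose p) S ≡ multichoose (suc p) S
cumsum-multichoose p zero    = multichoose-zero p
cumsum-multichoose p (suc S) = cong (_+ multichoose p (suc S)) (cumsum-multichoose p S)

cumsum^ : ℕ → (ℕ → ℕ) → ℕ → ℕ
cumsum^ zero    f = f
cumsum^ (suc q) f = cumsum (cumsum^ q f)

cumsum^-cong-≤ : ∀ q {f g} S → (∀ t → t ≤ S → f t ≡ g t) → cumsum^ q f S ≡ cumsum^ q g S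
cumsum^-cong-≤ zero    S f≗g = f≗g S ≤-refl
cumsum^-cong-≤ (suc q) S f≗g =
  cumsum-cong-≤ S (λ t t≤S → cumsum^-cong-≤ q t (λ u u≤t → f≗g u (≤-trans u≤t t≤S)))

cumsum^-+ : ∀ q f g S → cumsum^ q (λ t → f t + g t) S ≡ cumsum^ q f S + cumsum^ q g S
cumsum^-+ zero    f g S = refl
cumsum^-+ (suc q) f g S =
  trans (cumsum-cong-≤ S (λ t _ → cumsum^-+ q f g t)) (cumsum-+ (cumsum^ q f) (cumsum^ q g) S)

cumsum^-* : ∀ q c f S → cumsum^ q (λ t → c * f t) S ≡ c * cumsum^ q f S
cumsum^-* zero    c f S = refl
cumsum^-* (suc q) c f S = trans (cumsum-cong-≤ S (λ t _ → cumsum^-* q c f t)) (cumsum-* c (cumsum^ q f) S)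

cumsum^-zero : ∀ q S → cumsum^ q (λ _ → 0) S ≡ 0
cumsum^-zero q S = cumsum^-* q 0 (λ _ → 0) S

cumsum^-shift : ∀ q f S → cumsum^ q (shift f) S ≡ shift (cumsum^ q f) S
cumsum^-shift zero    f S = refl
cumsum^-shift (suc q) f S = trans (cumsum-cong-≤ S (λ t _ → cumsum^-shift q f t)) (cumsum-shift (cumsum^ q f) S)

cumsum^-multichoose : ∀ q p S → cumsum^ q (multichoose p) S ≡ multichoose (q + p) S
cumsum^-multichoose zero    p S = refl
cumsum^-multichoose (suc q) p S =
  trans (cumsum-cong-≤ S (λ t _ → cumsum^-multichoose q p t)) (cumsum-multichoose (q + p) S)

module ForestCount (q : ℕ) where

  -- The number of forests with N edges, K leaves and slack S (IsForest, forests-↔); a forest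
  -- with an edge has a tree, so its slack is below K.
  forests : ℕ → ℕ → ℕ → ℕ
  forests zero    zero    zero    = 1
  forests zero    zero    (suc S) = 0
  forests zero    (suc K) S       = 0
  forests (suc N) zero    S       = 0
  forests (suc N) (suc K) S with S ≤? K
  ... | yes _ = forests N K S + cumsum^ q (forests N (suc K)) S
  ... | no  _ = 0

  trees : ℕ → ℕ → ℕ
  trees n k = cumsum (forests (suc n) (suc k)) k

  weighted : (ℕ → ℕ → ℕ) → ℕ → ℕ → ℕ → ℕ
  weighted g N K S = choose N K * g (q * (N ∸ K)) S

  module _ (g : ℕ → ℕ → ℕ) (cumsum^-g : ∀ p S → cumsum^ q (g p) S ≡ g (q + p) S) where

    weighted-suc-zero : ∀ N S → weighted g (suc N) zero S ≡ cumsum^ q (weighted g N zero) S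
    weighted-suc-zero N S = begin
      1 * g (q * suc N) S            ≡⟨ cong (λ p → 1 * g p S) (*-suc q N) ⟩
      1 * g (q + q * N) S            ≡⟨ cong (1 *_) (cumsum^-g (q * N) S) ⟨
      1 * cumsum^ q (g (q * N)) S    ≡⟨ cumsum^-* q 1 (g (q * N)) S ⟨
      cumsum^ q (weighted g N zero) S ∎

    weighted-suc-suc : ∀ N K S →
      weighted g (suc N) (suc K) S ≡ weighted g N K S + cumsum^ q (weighted g N (suc K)) S
    weighted-suc-suc N K S = begin
      choose (suc N) (suc K) * g (q * (N ∸ K)) S
        ≡⟨ *-distribʳ-+ (g (q * (N ∸ K)) S) (choose N K) (choose N (suc K)) ⟩
      weighted g N K S + choose N (suc K) * g (q * (N ∸ K)) S
        ≡⟨ cong (weighted g N K S +_) (choose-*-cong N (suc K) (λ K<N → cong (λ p → g p S) (*-suc-∸ q K<N))) ⟨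
      weighted g N K S + choose N (suc K) * g (q + q * (N ∸ suc K)) S
        ≡⟨ cong (λ x → weighted g N K S + choose N (suc K) * x) (cumsum^-g (q * (N ∸ suc K)) S) ⟨
      weighted g N K S + choose N (suc K) * cumsum^ q (g (q * (N ∸ suc K))) S
        ≡⟨ cong (weighted g N K S +_) (cumsum^-* q (choose N (suc K)) (g (q * (N ∸ suc K))) S) ⟨
      weighted g N K S + cumsum^ q (weighted g N (suc K)) S ∎

  leading : ℕ → ℕ → ℕ → ℕ
  leading N zero    S = 0
  leading N (suc K) S = weighted multichoose N K S

  correction : ℕ → ℕ → ℕ → ℕ
  correction = weighted (λ p S → q * shift (multichoose (suc (q + p))) S)

  leading-step : ∀ N K S → leading (suc N) (suc K) S ≡ leading N K S + cumsum^ q (leading N (suc K)) S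
  leading-step N zero    S = weighted-suc-zero multichoose (cumsum^-multichoose q) N S
  leading-step N (suc K) S = weighted-suc-suc multichoose (cumsum^-multichoose q) N K S

  correction-step : ∀ N K S → correction (suc N) (suc K) S ≡ correction N K S + cumsum^ q (correction N (suc K)) S
  correction-step = weighted-suc-suc _ cumsum^-shifted
    where
    cumsum^-shifted : ∀ p S → cumsum^ q (λ t → q * shift (multichoose (suc (q + p))) t) S
                                ≡ q * shift (multichoose (suc (q + (q + p)))) S
    cumsum^-shifted p S = begin
      cumsum^ q (λ t → q * shift (multichoose (suc (q + p))) t) S
        ≡⟨ cumsum^-* q q _ S ⟩
      q * cumsum^ q (shift (multichoose (suc (q + p)))) S
        ≡⟨ cong (q *_) (cumsum^-shift q _ S) ⟩
      q * shift (cumsum^ q (multichoose (suc (q + p)))) S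
        ≡⟨ cong (q *_) (shift-cong S λ t →
             trans (cumsum^-multichoose q _ t) (cong (λ r → multichoose r t) (+-suc q (q + p)))) ⟩
      q * shift (multichoose (suc (q + (q + p)))) S ∎

  correction≡leading-diagonal : ∀ N K → correction N (suc K) (suc K) ≡ leading N (suc K) (suc K)
  correction≡leading-diagonal N K = *-cancelˡ-≡ _ _ (suc K) (begin
    suc K * (choose N (suc K) * (q * multichoose (suc (q + q * (N ∸ suc K))) K))
      ≡⟨ cong (suc K *_) (choose-*-cong N (suc K) λ K<N →
           cong (λ p → q * multichoose (suc p) K) (*-suc-∸ q K<N)) ⟩
    suc K * (choose N (suc K) * (q * multichoose (suc m) K))
      ≡⟨ *-assoc (suc K) (choose N (suc K)) _ ⟨
    suc K * choose N (suc K) * (q * multichoose (suc m) K)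
      ≡⟨ cong (_* (q * multichoose (suc m) K)) (choose-suc-ratio N K) ⟩
    (N ∸ K) * choose N K * (q * multichoose (suc m) K)
      ≡⟨ [a*b]*[c*d]≡b*[c*a*d] (N ∸ K) (choose N K) q (multichoose (suc m) K) ⟩
    choose N K * (m * multichoose (suc m) K)
      ≡⟨ cong (choose N K *_) (*-multichoose m (suc K)) ⟨
    choose N K * (suc K * multichoose m (suc K))
      ≡⟨ *-left-swap (choose N K) (suc K) _ ⟩
    suc K * (choose N K * multichoose m (suc K)) ∎)
    where
    m = q * (N ∸ K)

  forests-closed-form : ∀ N K S → S ≤ K → forests (suc N) K S + correction N K S ≡ leading N K S
  forests-closed-form-step : ∀ N K S → S ≤ K →
    forests N K S + cumsum^ q (forests N (suc K)) S + correction N (suc K) S ≡ leading N (suc K) S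

  forests-closed-form N zero    .zero z≤n = trans (cong (choose N 0 *_) (*-zeroʳ q)) (*-zeroʳ (choose N 0))
  forests-closed-form N (suc K) S     S≤1+K with S ≤? K
  ... | yes S≤K = forests-closed-form-step N K S S≤K
  ... | no  S≰K rewrite ≤-antisym S≤1+K (≰⇒> S≰K) = correction≡leading-diagonal N K  -- no forest has slack K

  forests-closed-form-step zero zero .zero z≤n =
    trans (cong₂ (λ x y → 1 + x + y) (cumsum^-zero q 0) (*-zeroʳ (choose 0 1)))
          (sym (trans (*-identityˡ _) (multichoose-zero (q * 0))))
  forests-closed-form-step zero (suc K) S _ = cong (_+ 0) (cumsum^-zero q S)
  forests-closed-form-step (suc N) K S S≤K = begin
    F K S + cumsum^ q (F (suc K)) S + correction (suc N) (suc K) S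
      ≡⟨ cong (F K S + cumsum^ q (F (suc K)) S +_) (correction-step N K S) ⟩
    F K S + cumsum^ q (F (suc K)) S + (C K S + cumsum^ q (C (suc K)) S)
      ≡⟨ +-interchange (F K S) _ (C K S) _ ⟩
    (F K S + C K S) + (cumsum^ q (F (suc K)) S + cumsum^ q (C (suc K)) S)
      ≡⟨ cong (F K S + C K S +_) (cumsum^-+ q (F (suc K)) (C (suc K)) S) ⟨
    (F K S + C K S) + cumsum^ q (λ t → F (suc K) t + C (suc K) t) S
      ≡⟨ cong₂ _+_ (forests-closed-form N K S S≤K)
                   (cumsum^-cong-≤ q S (λ t t≤S → forests-closed-form N (suc K) t (≤-trans t≤S (m≤n⇒m≤1+n S≤K)))) ⟩
    leading N K S + cumsum^ q (leading N (suc K)) S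
      ≡⟨ leading-step N K S ⟨
    leading (suc N) (suc K) S ∎
    where
    F = forests (suc N)
    C = correction N

  suc-*-cumsum-leading : ∀ n k → let m = q * (n ∸ k) in suc n * cumsum (leading n (suc k)) k
    ≡ choose (suc n) (suc k) * (multichoose (suc (suc m)) k + m * shift (multichoose (suc (suc m))) k)
  suc-*-cumsum-leading n k = begin
    suc n * cumsum (λ S → choose n k * multichoose m S) k
      ≡⟨ cong (suc n *_) (trans (cumsum-* (choose n k) (multichoose m) k)
                                (cong (choose n k *_) (cumsum-multichoose m k))) ⟩
    suc n * (choose n k * multichoose (suc m) k)
      ≡⟨ *-assoc (suc n) (choose n k) _ ⟨
    suc n * choose n k * multichoose (suc m) k
      ≡⟨ cong (_* multichoose (suc m) k) (choose-absorption n k) ⟩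
    suc k * choose (suc n) (suc k) * multichoose (suc m) k
      ≡⟨ trans (*-assoc (suc k) (choose (suc n) (suc k)) _) (*-left-swap (suc k) (choose (suc n) (suc k)) _) ⟩
    choose (suc n) (suc k) * (suc k * multichoose (suc m) k)
      ≡⟨ cong (choose (suc n) (suc k) *_) (suc-*-multichoose m k) ⟩
    choose (suc n) (suc k) * (multichoose (suc (suc m)) k + m * shift (multichoose (suc (suc m))) k) ∎
    where m = q * (n ∸ k)

  suc-*-cumsum-correction : ∀ n k → let m = q * (n ∸ k) in
    suc n * cumsum (correction n (suc k)) k ≡ choose (suc n) (suc k) * (m * shift (multichoose (suc (suc m))) k)
  suc-*-cumsum-correction n k = begin
    suc n * cumsum (λ S → choose n (suc k) * (q * shift (multichoose (suc p)) S)) k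
      ≡⟨ cong (suc n *_) (trans (cumsum-* (choose n (suc k)) _ k) (cong (choose n (suc k) *_) Σshift)) ⟩
    suc n * (choose n (suc k) * (q * shift (multichoose (suc (suc p))) k))
      ≡⟨ cong (suc n *_) (choose-*-cong n (suc k) λ k<n →
           cong (λ r → q * shift (multichoose (suc (suc r))) k) (*-suc-∸ q k<n)) ⟩
    suc n * (choose n (suc k) * (q * s))
      ≡⟨ *-assoc (suc n) (choose n (suc k)) _ ⟨
    suc n * choose n (suc k) * (q * s)
      ≡⟨ cong (_* (q * s)) (choose-absorption-suc n k) ⟩
    (n ∸ k) * choose (suc n) (suc k) * (q * s)
      ≡⟨ [a*b]*[c*d]≡b*[c*a*d] (n ∸ k) (choose (suc n) (suc k)) q s ⟩
    choose (suc n) (suc k) * (m * s) ∎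
    where
    m = q * (n ∸ k)
    p = q + q * (n ∸ suc k)
    s = shift (multichoose (suc (suc m))) k
    Σshift : cumsum (λ S → q * shift (multichoose (suc p)) S) k ≡ q * shift (multichoose (suc (suc p))) k
    Σshift = trans (cumsum-* q _ k)
                   (cong (q *_) (trans (cumsum-shift _ k) (shift-cong k (cumsum-multichoose (suc p)))))

  trees-closed-form : ∀ n k → suc n * trees n k ≡ choose (suc n) (suc k) * multichoose (suc (suc (q * (n ∸ k)))) k
  trees-closed-form n k = +-cancelʳ-≡ (C′ * (m * s)) _ _ (begin
    suc n * trees n k + C′ * (m * s)
      ≡⟨ cong (suc n * trees n k +_) (suc-*-cumsum-correction n k) ⟨
    suc n * trees n k + suc n * cumsum (correction n (suc k)) k
      ≡⟨ *-distribˡ-+ (suc n) (trees n k) _ ⟨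
    suc n * (trees n k + cumsum (correction n (suc k)) k)
      ≡⟨ cong (suc n *_) (cumsum-+ (forests (suc n) (suc k)) (correction n (suc k)) k) ⟨
    suc n * cumsum (λ S → forests (suc n) (suc k) S + correction n (suc k) S) k
      ≡⟨ cong (suc n *_) (cumsum-cong-≤ k (λ S S≤k → forests-closed-form n (suc k) S (m≤n⇒m≤1+n S≤k))) ⟩
    suc n * cumsum (leading n (suc k)) k
      ≡⟨ suc-*-cumsum-leading n k ⟩
    C′ * (multichoose (suc (suc m)) k + m * s)
      ≡⟨ *-distribˡ-+ C′ _ (m * s) ⟩
    C′ * multichoose (suc (suc m)) k + C′ * (m * s) ∎)
    where
    m = q * (n ∸ k)
    C′ = choose (suc n) (suc k)
    s = shift (multichoose (suc (suc m))) k

Σ-≡-proj₁ : {A : Set} {P : A → Set} → (∀ a → Irrelevant (P a)) → {x y : Σ A P} → proj₁ x ≡ proj₁ y → x ≡ y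
Σ-≡-proj₁ P-irr {a , p} {.a , p′} refl = cong (a ,_) (P-irr a p p′)

mk↔-subtype : {A B : Set} {P : A → Set} {Q : B → Set} → (∀ a → Irrelevant (P a)) → (∀ b → Irrelevant (Q b)) →
              (f : Σ A P → Σ B Q) (g : Σ B Q → Σ A P) →
              (∀ y → proj₁ (f (g y)) ≡ proj₁ y) → (∀ x → proj₁ (g (f x)) ≡ proj₁ x) → Σ A P ↔ Σ B Q
mk↔-subtype P-irr Q-irr f g f∘g g∘f =
  mk↔ₛ′ f g (λ y → Σ-≡-proj₁ Q-irr (f∘g y)) (λ x → Σ-≡-proj₁ P-irr (g∘f x))

contractible→↔Fin1 : {A : Set} (a : A) → (∀ b → b ≡ a) → A ↔ Fin 1
contractible→↔Fin1 a b≡a = ↔-trans (mk↔ₛ′ (λ _ → tt) (λ _ → a) (λ _ → refl) (λ b → sym (b≡a b))) (↔-sym 1↔⊤)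

¬→↔Fin0 : {A : Set} → ¬ A → A ↔ Fin 0
¬→↔Fin0 ¬a = mk↔ₛ′ (λ a → ⊥-elim (¬a a)) (λ ()) (λ ()) (λ a → ⊥-elim (¬a a))

⊎-↔-Fin+ : {A B : Set} {m n : ℕ} → A ↔ Fin m → B ↔ Fin n → (A ⊎ B) ↔ Fin (m + n)
⊎-↔-Fin+ A↔m B↔n = ↔-trans (A↔m ⊎-↔ B↔n) (↔-sym +↔⊎)

×-irrelevant : {A B : Set} → Irrelevant A → Irrelevant B → Irrelevant (A × B)
×-irrelevant A-irr B-irr (a , b) (a′ , b′) = cong₂ _,_ (A-irr a a′) (B-irr b b′)

module _ {U : Set} (R : ℕ → U → Set) where

  Bounded : ℕ → ℕ × U → Set
  Bounded S (t , u) = t ≤ S × R t u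

  Slack : ∀ q → ℕ → Vec ℕ q × U → Set
  Slack q S (v , u) = vsum v ≤ S × R (S ∸ vsum v) u

module _ {U : Set} {R : ℕ → U → Set} (R-irr : ∀ t u → Irrelevant (R t u)) where

  Bounded-irr : ∀ S p → Irrelevant (Bounded R S p)
  Bounded-irr S (t , u) = ×-irrelevant ≤-irrelevant (R-irr t u)

  Bounded-zero-↔ : Σ (ℕ × U) (Bounded R 0) ↔ Σ U (R 0)
  Bounded-zero-↔ = mk↔ₛ′ to (λ (u , r) → (0 , u) , z≤n , r) (λ _ → refl) from∘to
    where
    to : Σ (ℕ × U) (Bounded R 0) → Σ U (R 0)
    to ((.0 , u) , z≤n , r) = u , r
    from∘to : ∀ x → ((0 , proj₁ (to x)) , z≤n , proj₂ (to x)) ≡ x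
    from∘to ((.0 , u) , z≤n , r) = refl

  Bounded-suc-↔ : ∀ S → Σ (ℕ × U) (Bounded R (suc S)) ↔ (Σ (ℕ × U) (Bounded R S) ⊎ Σ U (R (suc S)))
  Bounded-suc-↔ S = mk↔ₛ′ to from to∘from from∘to
    where
    to : Σ (ℕ × U) (Bounded R (suc S)) → Σ (ℕ × U) (Bounded R S) ⊎ Σ U (R (suc S))
    to ((t , u) , t≤1+S , r) with t ≤? S
    ... | yes t≤S = inj₁ ((t , u) , t≤S , r)
    ... | no  t≰S = inj₂ (u , subst (λ t → R t u) (≤-antisym t≤1+S (≰⇒> t≰S)) r)
    from : Σ (ℕ × U) (Bounded R S) ⊎ Σ U (R (suc S)) → Σ (ℕ × U) (Bounded R (suc S))
    from (inj₁ ((t , u) , t≤S , r)) = (t , u) , m≤n⇒m≤1+n t≤S , r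
    from (inj₂ (u , r))             = (suc S , u) , ≤-refl , r
    to∘from : ∀ y → to (from y) ≡ y
    to∘from (inj₁ ((t , u) , t≤S , r)) with t ≤? S
    ... | yes t≤S′ = cong (λ t≤S → inj₁ ((t , u) , t≤S , r)) (≤-irrelevant t≤S′ t≤S)
    ... | no  t≰S  = ⊥-elim (t≰S t≤S)
    to∘from (inj₂ (u , r)) with suc S ≤? S
    ... | yes 1+S≤S = ⊥-elim (<-irrefl refl 1+S≤S)
    ... | no  _     = cong (λ r → inj₂ (u , r)) (R-irr (suc S) u _ _)
    from∘to : ∀ x → from (to x) ≡ x
    from∘to ((t , u) , t≤1+S , r) with t ≤? S
    ... | yes _   = Σ-≡-proj₁ (Bounded-irr (suc S)) refl
    ... | no  t≰S with ≤-antisym t≤1+S (≰⇒> t≰S)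
    ...   | refl = Σ-≡-proj₁ (Bounded-irr (suc S)) refl

  cumsum-↔ : ∀ {h} → (∀ t → Σ U (R t) ↔ Fin (h t)) → ∀ S → Σ (ℕ × U) (Bounded R S) ↔ Fin (cumsum h S)
  cumsum-↔ R↔h zero    = ↔-trans Bounded-zero-↔ (R↔h 0)
  cumsum-↔ R↔h (suc S) = ↔-trans (Bounded-suc-↔ S) (⊎-↔-Fin+ (cumsum-↔ R↔h S) (R↔h (suc S)))

module _ {U : Set} {R : ℕ → U → Set} (R-irr : ∀ t u → Irrelevant (R t u)) where

  Slack-irr : ∀ q S p → Irrelevant (Slack R q S p)
  Slack-irr q S (v , u) = ×-irrelevant ≤-irrelevant (R-irr (S ∸ vsum v) u)

  Slack-suc-↔ : ∀ q S →
    Σ (Vec ℕ (suc q) × U) (Slack R (suc q) S) ↔ Σ (ℕ × (Vec ℕ q × U)) (Bounded (Slack R q) S)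
  Slack-suc-↔ q S = mk↔-subtype (Slack-irr (suc q) S) (Bounded-irr (Slack-irr q) S) to from to∘from from∘to
    where
    to : Σ (Vec ℕ (suc q) × U) (Slack R (suc q) S) → Σ (ℕ × (Vec ℕ q × U)) (Bounded (Slack R q) S)
    to ((x ∷ v , u) , x+v≤S , r) =
      (S ∸ x , v , u) , m∸n≤m S x , m+n≤o⇒m≤o∸n (vsum v) (≤-trans (≤-reflexive (+-comm (vsum v) x)) x+v≤S) ,
      subst (λ t → R t u) (sym (∸-+-assoc S x (vsum v))) r
    from : Σ (ℕ × (Vec ℕ q × U)) (Bounded (Slack R q) S) → Σ (Vec ℕ (suc q) × U) (Slack R (suc q) S)
    from ((t , v , u) , t≤S , v≤t , r) =
      ((S ∸ t) ∷ v , u) , ≤-trans (+-monoʳ-≤ (S ∸ t) v≤t) (≤-reflexive (m∸n+n≡m t≤S)) ,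
      subst (λ t → R t u) (trans (cong (_∸ vsum v) (sym (m∸[m∸n]≡n t≤S))) (∸-+-assoc S (S ∸ t) (vsum v))) r
    to∘from : ∀ y → proj₁ (to (from y)) ≡ proj₁ y
    to∘from ((t , v , u) , t≤S , _) = cong (λ t → t , v , u) (m∸[m∸n]≡n t≤S)
    from∘to : ∀ x → proj₁ (from (to x)) ≡ proj₁ x
    from∘to ((x ∷ v , u) , x+v≤S , _) =
      cong (λ x → x ∷ v , u) (m∸[m∸n]≡n (≤-trans (m≤m+n x (vsum v)) x+v≤S))

  cumsum^-↔ : ∀ {h} → (∀ t → Σ U (R t) ↔ Fin (h t)) →
              ∀ q S → Σ (Vec ℕ q × U) (Slack R q S) ↔ Fin (cumsum^ q h S)
  cumsum^-↔ R↔h zero    S =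
    ↔-trans (mk↔-subtype (Slack-irr 0 S) (R-irr S) to (λ (u , r) → ([] , u) , z≤n , r) (λ _ → refl) from∘to) (R↔h S)
    where
    to : Σ (Vec ℕ 0 × U) (Slack R 0 S) → Σ U (R S)
    to (([] , u) , _ , r) = u , r
    from∘to : ∀ x → ([] , proj₁ (to x)) ≡ proj₁ x
    from∘to (([] , u) , _) = refl
  cumsum^-↔ R↔h (suc q) S = ↔-trans (Slack-suc-↔ q S) (cumsum-↔ (Slack-irr q) (λ t → cumsum^-↔ R↔h q t) S)

take-length-++ : {A : Set} (xs ys : List A) → take (length xs) (xs ++ ys) ≡ xs
take-length-++ []       ys = refl
take-length-++ (x ∷ xs) ys = cong (x ∷_) (take-length-++ xs ys)

drop-length-++ : {A : Set} (xs ys : List A) → drop (length xs) (xs ++ ys) ≡ ys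
drop-length-++ []       ys = refl
drop-length-++ (x ∷ xs) ys = drop-length-++ xs ys

module _ {d : ℕ} where

  edgesL-++ : (ss ts : List (SubTree d)) → edgesL (ss ++ ts) ≡ edgesL ss + edgesL ts
  edgesL-++ []       ts = refl
  edgesL-++ (s ∷ ss) ts = trans (cong (suc (edgesS s) +_) (edgesL-++ ss ts)) (sym (+-assoc (suc (edgesS s)) _ _))

  leavesL-++ : (ss ts : List (SubTree d)) → leavesL (ss ++ ts) ≡ leavesL ss + leavesL ts
  leavesL-++ []       ts = refl
  leavesL-++ (s ∷ ss) ts = trans (cong (leavesS s +_) (leavesL-++ ss ts)) (sym (+-assoc (leavesS s) _ _))

  1≤leavesS : (t : SubTree d) → 1 ≤ leavesS t
  1≤leavesS leaf          = s≤s z≤n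
  1≤leavesS (node c cs _) = ≤-trans (1≤leavesS c) (m≤m+n (leavesS c) (leavesL cs))

  length≤leavesL : (ts : List (SubTree d)) → length ts ≤ leavesL ts
  length≤leavesL []       = z≤n
  length≤leavesL (t ∷ ts) = +-mono-≤ (1≤leavesS t) (length≤leavesL ts)

module TreeCount (d : ℕ) where

  open ForestCount (d ∸ 1)

  -- N also counts the edge above each root, and K ∸ S is the number of trees.
  IsForest : ℕ → ℕ → ℕ → List (SubTree d) → Set
  IsForest N K S ts = edgesL ts ≡ N × leavesL ts ≡ K × length ts + S ≡ K

  IsForest-irr : ∀ N K S ts → Irrelevant (IsForest N K S ts)
  IsForest-irr N K S ts = ×-irrelevant ≡-irrelevant (×-irrelevant ≡-irrelevant ≡-irrelevant)

  Forests : ℕ → ℕ → ℕ → Set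
  Forests N K S = Σ (List (SubTree d)) (IsForest N K S)

  LabelledForests : ℕ → ℕ → ℕ → Set
  LabelledForests N K S = Σ (Vec ℕ (d ∸ 1) × List (SubTree d)) (Slack (IsForest N K) (d ∸ 1) S)

  Trees : ℕ → ℕ → Set
  Trees n k = Σ (Tree d) (λ t → edges t ≡ suc n × leaves t ≡ suc k)

  node-≡ : ∀ {c : SubTree d} {cs cs′ v} {p : vsum v ≡ length cs} {p′ : vsum v ≡ length cs′} →
           cs′ ≡ cs → node c cs′ (comp v p′) ≡ node c cs (comp v p)
  node-≡ {c} {cs} {v = v} refl = cong (λ p → node c cs (comp v p)) (≡-irrelevant _ _)

  -- Delete the root of the first tree: a leaf just disappears, while a node labelled v is
  -- replaced by its 1 + vsum v children, so the number of trees grows and the slack drops by vsum v.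
  forest-split-↔ : ∀ N K S → S ≤ K → Forests (suc N) (suc K) S ↔ (Forests N K S ⊎ LabelledForests N (suc K) S)
  forest-split-↔ N K S S≤K = mk↔ₛ′ to from to∘from from∘to
    where
    to : Forests (suc N) (suc K) S → Forests N K S ⊎ LabelledForests N (suc K) S
    to ([] , () , _)
    to (leaf ∷ ts , e , l , len) = inj₁ (ts , suc-injective e , suc-injective l , suc-injective len)
    to (node c cs (comp v v≡cs) ∷ ts , e , l , len) = inj₂ ((v , c ∷ cs ++ ts) , v≤S , e′ , l′ , len′)
      where
      e′ : suc (edgesS c) + edgesL (cs ++ ts) ≡ N
      e′ = trans (cong (suc (edgesS c) +_) (edgesL-++ cs ts))
                 (trans (sym (+-assoc (suc (edgesS c)) _ _)) (suc-injective e))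
      l′ : leavesS c + leavesL (cs ++ ts) ≡ suc K
      l′ = trans (cong (leavesS c +_) (leavesL-++ cs ts)) (trans (sym (+-assoc (leavesS c) _ _)) l)
      cs+ts≤K : length cs + length ts ≤ K
      cs+ts≤K = s≤s⁻¹ (subst₂ _≤_ (cong suc (length-++ cs)) l′ (length≤leavesL (c ∷ cs ++ ts)))
      cs≤S : length cs ≤ S
      cs≤S = +-cancelʳ-≤ (length ts) _ _
        (subst (length cs + length ts ≤_) (trans (sym (suc-injective len)) (+-comm _ S)) cs+ts≤K)
      v≤S : vsum v ≤ S
      v≤S = subst (_≤ S) (sym v≡cs) cs≤S
      len′ : length (c ∷ cs ++ ts) + (S ∸ vsum v) ≡ suc K
      len′ = cong suc (begin
        length (cs ++ ts) + (S ∸ vsum v)        ≡⟨ cong₂ (λ a b → a + (S ∸ b)) (length-++ cs) v≡cs ⟩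
        length cs + length ts + (S ∸ length cs) ≡⟨ +-∸-assoc _ cs≤S ⟨
        length cs + length ts + S ∸ length cs   ≡⟨ cong (_∸ length cs) (+-assoc (length cs) _ _) ⟩
        length cs + (length ts + S) ∸ length cs ≡⟨ m+n∸m≡n (length cs) _ ⟩
        length ts + S                           ≡⟨ suc-injective len ⟩
        K                                       ∎)
    from : Forests N K S ⊎ LabelledForests N (suc K) S → Forests (suc N) (suc K) S
    from (inj₁ (ts , e , l , len)) = leaf ∷ ts , cong suc e , cong suc l , cong suc len
    from (inj₂ ((v , []) , _ , _ , () , _))
    from (inj₂ ((v , c ∷ rest) , v≤S , e , l , len)) =
      node c cs′ (comp v v≡cs) ∷ ts′ , cong suc e′ , l′ , cong suc len′
      where
      cs′ = take (vsum v) rest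
      ts′ = drop (vsum v) rest
      rest≡ : cs′ ++ ts′ ≡ rest
      rest≡ = take++drop≡id (vsum v) rest
      v≤rest : vsum v ≤ length rest
      v≤rest = +-cancelʳ-≤ (S ∸ vsum v) _ _ (subst₂ _≤_ (sym (m+[n∸m]≡n v≤S)) (sym (suc-injective len)) S≤K)
      v≡cs : vsum v ≡ length cs′
      v≡cs = sym (trans (length-take (vsum v) rest) (m≤n⇒m⊓n≡m v≤rest))
      e′ : suc (edgesS c) + edgesL cs′ + edgesL ts′ ≡ N
      e′ = trans (+-assoc (suc (edgesS c)) _ _)
                 (trans (cong (suc (edgesS c) +_) (trans (sym (edgesL-++ cs′ ts′)) (cong edgesL rest≡))) e)
      l′ : leavesS c + leavesL cs′ + leavesL ts′ ≡ suc K
      l′ = trans (+-assoc (leavesS c) _ _)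
                 (trans (cong (leavesS c +_) (trans (sym (leavesL-++ cs′ ts′)) (cong leavesL rest≡))) l)
      len′ : length ts′ + S ≡ K
      len′ = begin
        length ts′ + S             ≡⟨ cong (_+ S) (length-drop (vsum v) rest) ⟩
        length rest ∸ vsum v + S   ≡⟨ +-∸-comm S v≤rest ⟨
        length rest + S ∸ vsum v   ≡⟨ +-∸-assoc (length rest) v≤S ⟩
        length rest + (S ∸ vsum v) ≡⟨ suc-injective len ⟩
        K                          ∎
    to∘from : ∀ y → to (from y) ≡ y
    to∘from (inj₁ (ts , _)) = cong inj₁ (Σ-≡-proj₁ (IsForest-irr N K S) refl)
    to∘from (inj₂ ((v , []) , _ , _ , () , _))
    to∘from (inj₂ ((v , c ∷ rest) , _)) = cong inj₂ (Σ-≡-proj₁ (Slack-irr (IsForest-irr N (suc K)) (d ∸ 1) S)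
                                                               (cong (λ r → v , c ∷ r) (take++drop≡id (vsum v) rest)))
    from∘to : ∀ x → from (to x) ≡ x
    from∘to ([] , () , _)
    from∘to (leaf ∷ ts , _) = Σ-≡-proj₁ (IsForest-irr (suc N) (suc K) S) refl
    from∘to (node c cs (comp v v≡cs) ∷ ts , _) = Σ-≡-proj₁ (IsForest-irr (suc N) (suc K) S)
      (cong₂ _∷_ (node-≡ (trans (cong (λ n → take n (cs ++ ts)) v≡cs) (take-length-++ cs ts)))
                 (trans (cong (λ n → drop n (cs ++ ts)) v≡cs) (drop-length-++ cs ts)))

  forests-↔ : ∀ N K S → Forests N K S ↔ Fin (forests N K S)
  forests-↔ zero    zero    zero    = contractible→↔Fin1 ([] , refl , refl , refl) λ where
    ([] , _)         → Σ-≡-proj₁ (IsForest-irr 0 0 0) refl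
    (_ ∷ _ , () , _)
  forests-↔ zero    zero    (suc S) = ¬→↔Fin0 λ where
    ([] , _ , _ , ())
    (_ ∷ _ , () , _)
  forests-↔ zero    (suc K) S       = ¬→↔Fin0 λ where
    ([] , _ , () , _)
    (_ ∷ _ , () , _)
  forests-↔ (suc N) zero    S       = ¬→↔Fin0 λ where
    ([] , () , _)
    (_ ∷ _ , _ , _ , ())
  forests-↔ (suc N) (suc K) S with S ≤? K
  ... | yes S≤K = ↔-trans (forest-split-↔ N K S S≤K) (⊎-↔-Fin+ (forests-↔ N K S)
                    (cumsum^-↔ (IsForest-irr N (suc K)) (forests-↔ N (suc K)) (d ∸ 1) S))
  ... | no  S≰K = ¬→↔Fin0 λ where
    ([] , () , _)
    (_ ∷ ts , _ , _ , len) → S≰K (subst (S ≤_) (suc-injective len) (m≤n+m S (length ts)))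

  trees-↔ : ∀ n k → Trees n k ↔ Fin (trees n k)
  trees-↔ n k =
    ↔-trans (mk↔-subtype Trees-irr (Bounded-irr (IsForest-irr (suc n) (suc k)) k) to from to∘from from∘to)
            (cumsum-↔ (IsForest-irr (suc n) (suc k)) (forests-↔ (suc n) (suc k)) k)
    where
    Trees-irr : ∀ t → Irrelevant (edges t ≡ suc n × leaves t ≡ suc k)
    Trees-irr t = ×-irrelevant ≡-irrelevant ≡-irrelevant
    to : Trees n k → Σ (ℕ × List (SubTree d)) (Bounded (IsForest (suc n) (suc k)) k)
    to (root c cs , e , l) = (k ∸ length cs , c ∷ cs) , m∸n≤m k (length cs) , e , l , cong suc (m+[n∸m]≡n cs≤k)
      where
      cs≤k : length cs ≤ k
      cs≤k = s≤s⁻¹ (subst (length (c ∷ cs) ≤_) l (length≤leavesL (c ∷ cs)))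
    from : Σ (ℕ × List (SubTree d)) (Bounded (IsForest (suc n) (suc k)) k) → Trees n k
    from ((S , []) , _ , _ , () , _)
    from ((S , c ∷ cs) , _ , e , l , _) = root c cs , e , l
    to∘from : ∀ y → proj₁ (to (from y)) ≡ proj₁ y
    to∘from ((S , []) , _ , _ , () , _)
    to∘from ((S , c ∷ cs) , _ , _ , _ , len) =
      cong (λ S → S , c ∷ cs) (trans (cong (_∸ length cs) (sym (suc-injective len))) (m+n∸m≡n (length cs) S))
    from∘to : ∀ x → proj₁ (from (to x)) ≡ proj₁ x
    from∘to (root c cs , _) = refl

N≡trees : ∀ e n k → N (suc (suc e)) n k ≡ ForestCount.trees (suc e) n k
N≡trees e n k = begin
  (suc n C suc k) * ((n + (n ∸ k) * e + 1) C k) / suc n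
    ≡⟨ cong (_/ suc n) (cong₂ _*_ (choose≡C (suc n) (suc k)) (choose≡C _ k)) ⟨
  choose (suc n) (suc k) * choose (n + (n ∸ k) * e + 1) k / suc n
    ≡⟨ cong (_/ suc n) (choose-*-cong (suc n) (suc k) λ 1+k≤1+n →
         cong (λ m → choose m k) (upper-index≡ (s≤s⁻¹ 1+k≤1+n))) ⟩
  choose (suc n) (suc k) * choose (k + suc (suc e * (n ∸ k))) k / suc n
    ≡⟨ cong (λ m → choose (suc n) (suc k) * m / suc n) (multichoose≡choose (suc (suc e * (n ∸ k))) k) ⟨
  choose (suc n) (suc k) * multichoose (suc (suc (suc e * (n ∸ k)))) k / suc n
    ≡⟨ cong (_/ suc n) (trans (*-comm _ (suc n)) (ForestCount.trees-closed-form (suc e) n k)) ⟨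
  ForestCount.trees (suc e) n k * suc n / suc n
    ≡⟨ m*n/n≡m _ (suc n) ⟩
  ForestCount.trees (suc e) n k ∎
  where
  upper-index≡ : k ≤ n → n + (n ∸ k) * e + 1 ≡ k + suc (suc e * (n ∸ k))
  upper-index≡ k≤n = trans (cong (λ m → m + (n ∸ k) * e + 1) (sym (m+[n∸m]≡n k≤n))) (regroup k (n ∸ k) e)
    where
    regroup : ∀ k r e → k + r + r * e + 1 ≡ k + suc (suc e * r)
    regroup = solve-∀

theorem4p5 : (d n k : ℕ) → 2 ≤ d →
    Fin (N d n k) ↔ Σ (Tree d) (λ t → edges t ≡ suc n × leaves t ≡ suc k)
theorem4p5 (suc (suc e)) n k (s≤s (s≤s z≤n)) =
  subst (λ m → Fin m ↔ TreeCount.Trees (suc (suc e)) n k) (sym (N≡trees e n k))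
        (↔-sym (TreeCount.trees-↔ (suc (suc e)) n k))
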